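{- Let $J_2 = [9]\setminus\{2\}$. There exist subsets $I_1, I_3, I_4, \dots, I_9 \subseteq [4]$, each of size $3$, such that, with $\mathcal I = (I_1, I_3, \dots, I_9)$, the conditional predicate $R_2 \mid S_2$ is an $\mathcal I$-substructure of $\pi_{J_2}\operatorname{BoolBCK} \mid \pi_{J_2}\operatorname{BoolBCK}^{+}$.
   Context: $C_6 = \{(0,0),(0,1),(1,0),(1,2),(2,1),(2,2)\}$, $C_6^*=C_6\setminus\{(0,0)\}$, $S_2 = C_6\times C_6\subseteq\{0,1,2\}^4$, $R_2 = (C_6^*\times C_6)\cup(C_6\times C_6^*)$. $\operatorname{BoolBCK}^{+} = \{100010001, 010100001, 001010100, 100001010, 001100010, 010001100\}\subseteq\{0,1\}^9$ and $\operatorname{BoolBCK} = \operatorname{BoolBCK}^{+}\setminus\{100010001\}$; $\pi_{J_2}$ restricts to coordinates $1,3,4,\dots,9$, so the target predicates have arity $8$ with coordinates indexed by $J_2$. For $I\subseteq[r]$, $\pi_I x = (x_i: i\in I)$. For $P\subsetneq Q\subseteq D_1^{r_1}$, $R\subsetneq S\subseteq D_2^{r_2}$ and a sequence $\mathcal I=(I_j)$ of subsets of $[r_1]$ indexed by the $r_2$ output coordinates, $P\mid Q$ is an $\mathcal I$-substructure of $R\mid S$ if there exist maps $g_j : D_1^{I_j}\to D_2$ with $(g_j(\pi_{I_j}x))_j\in R$ for all $x\in P$ and $\in S\setminus R$ for all $x\in Q\setminus P$. -}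

module Defs where

open import Data.Nat using (ℕ)
open import Data.Bool using (Bool; true; false)
open import Data.Fin using (Fin; zero; suc; punchIn)
open import Data.Fin.Patterns using (0F; 1F; 2F)
open import Data.Fin.Subset using (Subset) renaming (_∈_ to _∈ₛ_)
open import Data.Product using (Σ; _×_; _,_; ∃)
open import Data.Sum using (_⊎_)
open import Data.List using (List; []; _∷_; map)
open import Data.List.Membership.Propositional using (_∈_)
open import Data.Vec using (Vec; []; _∷_; lookup; tabulate)
open import Relation.Nullary using (¬_)

-- D₁ = {0,1,2}, tuples of arity r as functions Fin r → Fin 3
-- C₆ ⊆ {0,1,2}²
C6 : List (Fin 3 × Fin 3)
C6 = (0F , 0F) ∷ (0F , 1F) ∷ (1F , 0F) ∷ (1F , 2F) ∷ (2F , 1F) ∷ (2F , 2F) ∷ []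

-- C₆* = C₆ ∖ {(0,0)}
C6* : List (Fin 3 × Fin 3)
C6* = (0F , 1F) ∷ (1F , 0F) ∷ (1F , 2F) ∷ (2F , 1F) ∷ (2F , 2F) ∷ []

S2 : (Fin 4 → Fin 3) → Set
S2 x = ((x 0F , x 1F) ∈ C6) × ((x 2F , x 3F) ∈ C6)
  where open import Data.Fin.Patterns using (3F)

R2 : (Fin 4 → Fin 3) → Set
R2 x = (((x 0F , x 1F) ∈ C6*) × ((x 2F , x 3F) ∈ C6))
     ⊎ (((x 0F , x 1F) ∈ C6) × ((x 2F , x 3F) ∈ C6*))
  where open import Data.Fin.Patterns using (3F)

-- Boolean tuples written as bit vectors (coordinate 1 is the first entry)
BoolBCK⁺ : List (Vec Bool 9)
BoolBCK⁺ =
    (true  ∷ false ∷ false ∷ false ∷ true  ∷ false ∷ false ∷ false ∷ true  ∷ [])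
  ∷ (false ∷ true  ∷ false ∷ true  ∷ false ∷ false ∷ false ∷ false ∷ true  ∷ [])
  ∷ (false ∷ false ∷ true  ∷ false ∷ true  ∷ false ∷ true  ∷ false ∷ false ∷ [])
  ∷ (true  ∷ false ∷ false ∷ false ∷ false ∷ true  ∷ false ∷ true  ∷ false ∷ [])
  ∷ (false ∷ false ∷ true  ∷ true  ∷ false ∷ false ∷ false ∷ true  ∷ false ∷ [])
  ∷ (false ∷ true  ∷ false ∷ false ∷ false ∷ true  ∷ true  ∷ false ∷ false ∷ [])
  ∷ []

-- BoolBCK = BoolBCK⁺ ∖ {100010001}
BoolBCK : List (Vec Bool 9)
BoolBCK =
    (false ∷ true  ∷ false ∷ true  ∷ false ∷ false ∷ false ∷ false ∷ true  ∷ [])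
  ∷ (false ∷ false ∷ true  ∷ false ∷ true  ∷ false ∷ true  ∷ false ∷ false ∷ [])
  ∷ (true  ∷ false ∷ false ∷ false ∷ false ∷ true  ∷ false ∷ true  ∷ false ∷ [])
  ∷ (false ∷ false ∷ true  ∷ true  ∷ false ∷ false ∷ false ∷ true  ∷ false ∷ [])
  ∷ (false ∷ true  ∷ false ∷ false ∷ false ∷ true  ∷ true  ∷ false ∷ false ∷ [])
  ∷ []

-- J₂ = [9] ∖ {2}: the j-th output coordinate (j : Fin 8) is coordinate
-- punchIn 1 j of Fin 9 (0-based index 1 = paper's coordinate 2 is skipped).
J2 : Fin 8 → Fin 9
J2 = punchIn (suc zero)

πJ2 : Vec Bool 9 → Vec Bool 8
πJ2 v = tabulate (λ j → lookup v (J2 j))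

πJ2-pred : List (Vec Bool 9) → Vec Bool 8 → Set
πJ2-pred P y = y ∈ map πJ2 P

Restr : ∀ {r} → Subset r → Set
Restr {r} I = Σ (Fin r) (λ i → i ∈ₛ I) → Fin 3

πI : ∀ {r} (I : Subset r) → (Fin r → Fin 3) → Restr I
πI I x (i , _) = x i

IsSubstructure : ∀ {r₁ r₂}
  (P Q : (Fin r₁ → Fin 3) → Set) (R S : Vec Bool r₂ → Set)
  (𝓘 : Fin r₂ → Subset r₁) → Set
IsSubstructure {r₁} {r₂} P Q R S 𝓘 =
  Σ ((j : Fin r₂) → Restr (𝓘 j) → Bool) λ g →
    let out : (Fin r₁ → Fin 3) → Vec Bool r₂
        out x = tabulate (λ j → g j (πI (𝓘 j) x))
    in ((x : Fin r₁ → Fin 3) → P x → R (out x))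
     × ((x : Fin r₁ → Fin 3) → Q x → ¬ P x → S (out x) × ¬ R (out x))

-- Read as 3×3 matrices, the rows of BoolBCK⁺ are the six permutation matrices,
-- BoolBCK omits the identity, and deleting entry (1,2) keeps them distinct.
-- Since R₂ ⊆ S₂ and S₂ ∖ R₂ = {0000}, it suffices to colour each point of
-- S₂ = C₆ × C₆ by a permutation, with only 0000 coloured by the identity, so
-- that on S₂ each of the eight remaining matrix entries ignores one of the
-- four coordinates.  Then g_j may read that entry off any point of S₂ lying
-- over its argument, and everything left is a finite check.
module Submission where

open import Defs
open import Data.Bool using (Bool)
open import Data.Bool.Properties using () renaming (_≟_ to _≟ᵇ_)
open import Data.Fin using (Fin; punchIn) renaming (_≟_ to _≟ᶠ_)
open import Data.Fin.Patterns using (0F; 1F; 2F; 3F; 4F; 5F)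
open import Data.Fin.Properties using (any?; all?; punchInᵢ≢i)
open import Data.Fin.Subset using (Subset; ∣_∣; ∁; ⁅_⁆) renaming (_∈_ to _∈ₛ_)
open import Data.Fin.Subset.Properties using (x∉p⇒x∈∁p; x≢y⇒x∉⁅y⁆; ∣∁p∣≡n∸∣p∣; ∣⁅x⁆∣≡1)
open import Data.List using (List)
import Data.List as List
import Data.List.Membership.DecPropositional as DecMembership
open import Data.Nat using (ℕ; suc; _∸_)
open import Data.Product using (Σ; _×_; _,_; proj₁; proj₂)
open import Data.Product.Properties using () renaming (≡-dec to ×-≡-dec)
open import Data.Vec using (Vec; []; _∷_; lookup; tabulate)
open import Data.Vec.Properties using () renaming (≡-dec to Vec-≡-dec)
import Data.Vec.Functional as Tuple
open import Relation.Binary.PropositionalEquality using (_≡_; trans; cong)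
open import Relation.Nullary using (Dec; does; ¬_; ¬?; _×-dec_; _⊎-dec_; _→-dec_; from-yes)
open import Relation.Nullary.Decidable using (T?)

private
  variable
    n : ℕ

module _ where
  open DecMembership (×-≡-dec (_≟ᶠ_ {3}) (_≟ᶠ_ {3}))

  S2? : (x : Fin 4 → Fin 3) → Dec (S2 x)
  S2? x = ((x 0F , x 1F) ∈? C6) ×-dec ((x 2F , x 3F) ∈? C6)

  R2? : (x : Fin 4 → Fin 3) → Dec (R2 x)
  R2? x = (((x 0F , x 1F) ∈? C6*) ×-dec ((x 2F , x 3F) ∈? C6))
        ⊎-dec (((x 0F , x 1F) ∈? C6) ×-dec ((x 2F , x 3F) ∈? C6*))

πJ2-pred? : (P : List (Vec Bool 9)) (y : Vec Bool 8) → Dec (πJ2-pred P y)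
πJ2-pred? P y = y ∈? List.map πJ2 P
  where open DecMembership (Vec-≡-dec {n = 8} _≟ᵇ_)

punchIn∈∁⁅⁆ : (k : Fin (suc n)) (i : Fin n) → punchIn k i ∈ₛ ∁ ⁅ k ⁆
punchIn∈∁⁅⁆ k i = x∉p⇒x∈∁p (x≢y⇒x∉⁅y⁆ (punchInᵢ≢i k i))

∣∁⁅⁆∣ : (k : Fin (suc n)) → ∣ ∁ ⁅ k ⁆ ∣ ≡ n
∣∁⁅⁆∣ {n} k = trans (∣∁p∣≡n∸∣p∣ ⁅ k ⁆) (cong (suc n ∸_) (∣⁅x⁆∣≡1 k))

removeAtₛ : (k : Fin (suc n)) → Restr (∁ ⁅ k ⁆) → Vec (Fin 3) n
removeAtₛ k y = tabulate (λ i → y (punchIn k i , punchIn∈∁⁅⁆ k i))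

tuple : Fin 3 → Fin 3 → Fin 3 → Fin 3 → Fin 4 → Fin 3
tuple a b c d = a Tuple.∷ b Tuple.∷ c Tuple.∷ d Tuple.∷ Tuple.[]

point : Fin 6 → Fin 6 → Fin 4 → Fin 3
point u v = tuple (proj₁ (List.lookup C6 u)) (proj₂ (List.lookup C6 u))
                  (proj₁ (List.lookup C6 v)) (proj₂ (List.lookup C6 v))

-- Entry (u , v) is the position in BoolBCK⁺ of the permutation colouring point u v.
colouring : Vec (Vec (Fin 6) 6) 6
colouring = (0F ∷ 1F ∷ 2F ∷ 5F ∷ 4F ∷ 3F ∷ [])
          ∷ (1F ∷ 1F ∷ 4F ∷ 3F ∷ 4F ∷ 3F ∷ [])
          ∷ (3F ∷ 4F ∷ 5F ∷ 5F ∷ 4F ∷ 3F ∷ [])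
          ∷ (5F ∷ 2F ∷ 5F ∷ 5F ∷ 2F ∷ 5F ∷ [])
          ∷ (4F ∷ 4F ∷ 4F ∷ 3F ∷ 4F ∷ 3F ∷ [])
          ∷ (2F ∷ 2F ∷ 2F ∷ 5F ∷ 2F ∷ 5F ∷ [])
          ∷ []

colour : Fin 6 → Fin 6 → Vec Bool 8
colour u v = πJ2 (List.lookup BoolBCK⁺ (lookup (lookup colouring u) v))

-- On S₂, bit j of the colour does not depend on coordinate dropped j.
dropped : Fin 8 → Fin 4
dropped = lookup (0F ∷ 1F ∷ 0F ∷ 2F ∷ 1F ∷ 0F ∷ 3F ∷ 1F ∷ [])

𝓘 : Fin 8 → Subset 4
𝓘 j = ∁ ⁅ dropped j ⁆

g : (j : Fin 8) → Restr (𝓘 j) → Bool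
g j y = does (any? λ u → any? λ v →
          Vec-≡-dec _≟ᶠ_ (tabulate (Tuple.removeAt (point u v) (dropped j))) (removeAtₛ (dropped j) y)
          ×-dec T? (lookup (colour u v) j))

output : (Fin 4 → Fin 3) → Vec Bool 8
output x = tabulate (λ j → g j (πI (𝓘 j) x))

-- R2, S2 and output evaluate x only at 0F … 3F, so in lemma4p9 x and
-- tuple (x 0F) (x 1F) (x 2F) (x 3F) are interchangeable definitionally.
R2⇒output∈πJ2BoolBCK : ∀ a b c d → R2 (tuple a b c d) → πJ2-pred BoolBCK (output (tuple a b c d))
R2⇒output∈πJ2BoolBCK = from-yes (all? λ a → all? λ b → all? λ c → all? λ d →
  R2? (tuple a b c d) →-dec πJ2-pred? BoolBCK (output (tuple a b c d)))

S2∖R2⇒output∈πJ2BoolBCK⁺∖πJ2BoolBCK : ∀ a b c d → S2 (tuple a b c d) → ¬ R2 (tuple a b c d) →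
  πJ2-pred BoolBCK⁺ (output (tuple a b c d)) × ¬ πJ2-pred BoolBCK (output (tuple a b c d))
S2∖R2⇒output∈πJ2BoolBCK⁺∖πJ2BoolBCK = from-yes (all? λ a → all? λ b → all? λ c → all? λ d →
  S2? (tuple a b c d) →-dec ¬? (R2? (tuple a b c d)) →-dec
    πJ2-pred? BoolBCK⁺ (output (tuple a b c d)) ×-dec ¬? (πJ2-pred? BoolBCK (output (tuple a b c d))))

lemma4p9 : Σ (Fin 8 → Subset 4) (λ 𝓘 →
             ((j : Fin 8) → ∣ 𝓘 j ∣ ≡ 3)
             × IsSubstructure R2 S2 (πJ2-pred BoolBCK) (πJ2-pred BoolBCK⁺) 𝓘)
lemma4p9 = 𝓘 , (λ j → ∣∁⁅⁆∣ (dropped j)) , g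
         , (λ x → R2⇒output∈πJ2BoolBCK (x 0F) (x 1F) (x 2F) (x 3F))
         , (λ x → S2∖R2⇒output∈πJ2BoolBCK⁺∖πJ2BoolBCK (x 0F) (x 1F) (x 2F) (x 3F))
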